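{- For all SCL-terms $P, Q \in \mathrm{ST}$: $\mathrm{se}(P) = \mathrm{se}(Q)$ if and only if $\mathrm{CP}_s \vdash P = Q$. That is, $\mathrm{FSCL}_{\mathrm{se}} \vDash P = Q \iff \mathrm{FSCL} \vDash P = Q$.
   Context: Let $A$ be a countable set of atoms. The set $\mathrm{ST}$ of SCL-terms is generated by $P ::= a \ (a \in A) \mid \mathsf{T} \mid \mathsf{F} \mid \neg P \mid (P \wedge^{\circ} P) \mid (P \vee^{\circ} P)$ (short-circuit left-sequential connectives). Let $\mathcal{T}$ be the set of finite binary trees: $\mathsf{T}, \mathsf{F} \in \mathcal{T}$ and $(X \trianglelefteq a \trianglerighteq Y) \in \mathcal{T}$ for $X, Y \in \mathcal{T}$, $a \in A$. Leaf replacement: $\mathsf{T}[\mathsf{T}\mapsto Y, \mathsf{F}\mapsto Z] = Y$, $\mathsf{F}[\mathsf{T}\mapsto Y, \mathsf{F}\mapsto Z] = Z$, $(X' \trianglelefteq a \trianglerighteq X'')[\mathsf{T}\mapsto Y, \mathsf{F}\mapsto Z] = X'[\ldots] \trianglelefteq a \trianglerighteq X''[\ldots]$; unmentioned leaves are unchanged. $\mathrm{se}: \mathrm{ST} \to \mathcal{T}$: $\mathrm{se}(\mathsf{T}) = \mathsf{T}$, $\mathrm{se}(\mathsf{F}) = \mathsf{F}$, $\mathrm{se}(a) = \mathsf{T} \trianglelefteq a \trianglerighteq \mathsf{F}$, $\mathrm{se}(\neg P) = \mathrm{se}(P)[\mathsf{T}\mapsto\mathsf{F}, \mathsf{F}\mapsto\mathsf{T}]$,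 $\mathrm{se}(P \wedge^{\circ} Q) = \mathrm{se}(P)[\mathsf{T}\mapsto \mathrm{se}(Q)]$, $\mathrm{se}(P \vee^{\circ} Q) = \mathrm{se}(P)[\mathsf{F}\mapsto \mathrm{se}(Q)]$; $\mathrm{FSCL}_{\mathrm{se}} \vDash P = Q$ iff $\mathrm{se}(P)=\mathrm{se}(Q)$. Proposition algebra: terms $\mathrm{CT}_s$ are generated by $P ::= a \mid \mathsf{T} \mid \mathsf{F} \mid P \triangleleft P \triangleright P \mid \neg P \mid P \wedge^{\circ} P \mid P \vee^{\circ} P$, where $y \triangleleft x \triangleright z$ is the conditional "if $x$ then $y$ else $z$". $\mathrm{CP}_s$ consists of the axioms $x \triangleleft \mathsf{T} \triangleright y = x$; $x \triangleleft \mathsf{F} \triangleright y = y$; $\mathsf{T} \triangleleft x \triangleright \mathsf{F} = x$; $x \triangleleft (y \triangleleft z \triangleright u) \triangleright v = (x \triangleleft y \triangleright v) \triangleleft z \triangleright (x \triangleleft u \triangleright v)$; together with $\neg x = \mathsf{F} \triangleleft x \triangleright \mathsf{T}$, $x \wedge^{\circ} y = y \triangleleft x \triangleright \mathsf{F}$, $x \vee^{\circ} y = \mathsf{T} \triangleleft x \triangleright y$. $\mathrm{CP}_s \vdash s = t$ denotes derivability by equational logic from $\mathrm{CP}_s$, and Free Short-Circuit Logic is defined by $\mathrm{FSCL} \vDash P = Q$ iff $\mathrm{CP}_s \vdash P = Q$ for $P, Q \in \mathrm{ST}$. -}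

module Defs where

open import Data.Nat using (ℕ)
open import Relation.Binary.PropositionalEquality using (_≡_)

module _ (A : Set) where

  data ST : Set where
    atom : A → ST
    T F  : ST
    ¬ˢ_  : ST → ST
    _∧ˢ_ : ST → ST → ST
    _∨ˢ_ : ST → ST → ST

  -- finite binary trees 𝒯 ;  node X a Y  stands for  X ⊴ a ⊵ Y
  data Tree : Set where
    T F  : Tree
    node : Tree → A → Tree → Tree

  repl : Tree → Tree → Tree → Tree
  repl T Y Z = Y
  repl F Y Z = Z
  repl (node X′ a X″) Y Z = node (repl X′ Y Z) a (repl X″ Y Z)

  se : ST → Tree
  se (atom a) = node T a F
  se T = T
  se F = F
  se (¬ˢ P) = repl (se P) F T
  se (P ∧ˢ Q) = repl (se P) (se Q) F
  se (P ∨ˢ Q) = repl (se P) T (se Q)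

  data CT : Set where
    var  : ℕ → CT
    atom : A → CT
    T F  : CT
    _◁_▷_ : CT → CT → CT → CT     -- y ◁ x ▷ z  = if x then y else z
    ¬ᶜ_  : CT → CT
    _∧ᶜ_ : CT → CT → CT
    _∨ᶜ_ : CT → CT → CT

  sub : (ℕ → CT) → CT → CT
  sub σ (var n) = σ n
  sub σ (atom a) = atom a
  sub σ T = T
  sub σ F = F
  sub σ (y ◁ x ▷ z) = sub σ y ◁ sub σ x ▷ sub σ z
  sub σ (¬ᶜ x) = ¬ᶜ sub σ x
  sub σ (x ∧ᶜ y) = sub σ x ∧ᶜ sub σ y
  sub σ (x ∨ᶜ y) = sub σ x ∨ᶜ sub σ y

  -- the axioms of CP_s (variables x,y,z,u,v = var 0..4)
  data Axiom : CT → CT → Set where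
    cp1 : Axiom (var 0 ◁ T ▷ var 1) (var 0)
    cp2 : Axiom (var 0 ◁ F ▷ var 1) (var 1)
    cp3 : Axiom (T ◁ var 0 ▷ F) (var 0)
    cp4 : Axiom (var 0 ◁ (var 1 ◁ var 2 ▷ var 3) ▷ var 4)
                ((var 0 ◁ var 1 ▷ var 4) ◁ var 2 ▷ (var 0 ◁ var 3 ▷ var 4))
    neg : Axiom (¬ᶜ var 0) (F ◁ var 0 ▷ T)
    and : Axiom (var 0 ∧ᶜ var 1) (var 1 ◁ var 0 ▷ F)
    or  : Axiom (var 0 ∨ᶜ var 1) (T ◁ var 0 ▷ var 1)

  data _⊢≈_ : CT → CT → Set where
    ax    : ∀ {s t} (σ : ℕ → CT) → Axiom s t → sub σ s ⊢≈ sub σ t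
    refl  : ∀ {s} → s ⊢≈ s
    sym   : ∀ {s t} → s ⊢≈ t → t ⊢≈ s
    trans : ∀ {s t u} → s ⊢≈ t → t ⊢≈ u → s ⊢≈ u
    cong◁ : ∀ {s s′ t t′ u u′} → s ⊢≈ s′ → t ⊢≈ t′ → u ⊢≈ u′ →
            (s ◁ t ▷ u) ⊢≈ (s′ ◁ t′ ▷ u′)
    cong¬ : ∀ {s s′} → s ⊢≈ s′ → (¬ᶜ s) ⊢≈ (¬ᶜ s′)
    cong∧ : ∀ {s s′ t t′} → s ⊢≈ s′ → t ⊢≈ t′ → (s ∧ᶜ t) ⊢≈ (s′ ∧ᶜ t′)
    cong∨ : ∀ {s s′ t t′} → s ⊢≈ s′ → t ⊢≈ t′ → (s ∨ᶜ t) ⊢≈ (s′ ∨ᶜ t′)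

  ⌜_⌝ : ST → CT
  ⌜ atom a ⌝ = atom a
  ⌜ T ⌝ = T
  ⌜ F ⌝ = F
  ⌜ ¬ˢ P ⌝ = ¬ᶜ ⌜ P ⌝
  ⌜ P ∧ˢ Q ⌝ = ⌜ P ⌝ ∧ᶜ ⌜ Q ⌝
  ⌜ P ∨ˢ Q ⌝ = ⌜ P ⌝ ∨ᶜ ⌜ Q ⌝

  FSCLse⊨ : ST → ST → Set
  FSCLse⊨ P Q = se P ≡ se Q

  FSCL⊨ : ST → ST → Set
  FSCL⊨ P Q = ⌜ P ⌝ ⊢≈ ⌜ Q ⌝

-- Soundness.  Finite binary trees with leaf replacement form a model of CP_s:
-- a conditional  y ◁ x ▷ z  is interpreted by replacing the T-leaves of the
-- tree of x by the tree of y and its F-leaves by the tree of z.  The axioms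
-- CP1–CP4 hold because leaf replacement has T/F as a right unit and is
-- associative; the defining axioms of ¬, ∧°, ∨° hold by definition.  On
-- SCL-terms this interpretation is exactly se, so derivable equations have
-- equal evaluation trees.
--
-- Completeness.  Every tree X is read back as a nested conditional ⌊ X ⌋ over
-- atoms.  Reading back a leaf replacement is provably a conditional (CP1,
-- CP2, CP4), hence every SCL-term is provably equal to ⌊ se P ⌋ (CP3 and the
-- defining axioms).  Two terms with the same tree are then provably equal.
module Submission where

open import Defs
open import Data.Nat using (ℕ)
open import Function.Bundles using (_⇔_; _↣_; mk⇔)
open import Relation.Binary.Bundles using (Setoid)
open import Relation.Binary.PropositionalEquality as ≡ using (_≡_; cong₂)
import Relation.Binary.Reasoning.Setoid as SetoidReasoning

module SoundAndComplete (A : Set) where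

  _≈_ : CT A → CT A → Set
  _≈_ = _⊢≈_ A

  infix 4 _≈_

  ⌜_⌝ˢ : ST A → CT A
  ⌜_⌝ˢ = ⌜_⌝ A

  repl-identity : ∀ X → repl A X T F ≡ X
  repl-identity T = ≡.refl
  repl-identity F = ≡.refl
  repl-identity (node X a Y) = cong₂ (λ L R → node L a R) (repl-identity X) (repl-identity Y)

  repl-assoc : ∀ Z Y U X V →
    repl A (repl A Z Y U) X V ≡ repl A Z (repl A Y X V) (repl A U X V)
  repl-assoc T Y U X V = ≡.refl
  repl-assoc F Y U X V = ≡.refl
  repl-assoc (node Z₁ a Z₂) Y U X V =
    cong₂ (λ L R → node L a R) (repl-assoc Z₁ Y U X V) (repl-assoc Z₂ Y U X V)

  ⟦_⟧ : CT A → (ℕ → Tree A) → Tree A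
  ⟦ var n ⟧ ρ = ρ n
  ⟦ atom a ⟧ ρ = node T a F
  ⟦ T ⟧ ρ = T
  ⟦ F ⟧ ρ = F
  ⟦ y ◁ x ▷ z ⟧ ρ = repl A (⟦ x ⟧ ρ) (⟦ y ⟧ ρ) (⟦ z ⟧ ρ)
  ⟦ ¬ᶜ x ⟧ ρ = repl A (⟦ x ⟧ ρ) F T
  ⟦ x ∧ᶜ y ⟧ ρ = repl A (⟦ x ⟧ ρ) (⟦ y ⟧ ρ) F
  ⟦ x ∨ᶜ y ⟧ ρ = repl A (⟦ x ⟧ ρ) T (⟦ y ⟧ ρ)

  ⟦sub⟧ : ∀ σ t ρ → ⟦ sub A σ t ⟧ ρ ≡ ⟦ t ⟧ (λ n → ⟦ σ n ⟧ ρ)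
  ⟦sub⟧ σ (var n) ρ = ≡.refl
  ⟦sub⟧ σ (atom a) ρ = ≡.refl
  ⟦sub⟧ σ T ρ = ≡.refl
  ⟦sub⟧ σ F ρ = ≡.refl
  ⟦sub⟧ σ (y ◁ x ▷ z) ρ
    rewrite ⟦sub⟧ σ x ρ | ⟦sub⟧ σ y ρ | ⟦sub⟧ σ z ρ = ≡.refl
  ⟦sub⟧ σ (¬ᶜ x) ρ rewrite ⟦sub⟧ σ x ρ = ≡.refl
  ⟦sub⟧ σ (x ∧ᶜ y) ρ rewrite ⟦sub⟧ σ x ρ | ⟦sub⟧ σ y ρ = ≡.refl
  ⟦sub⟧ σ (x ∨ᶜ y) ρ rewrite ⟦sub⟧ σ x ρ | ⟦sub⟧ σ y ρ = ≡.refl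

  axiom-valid : ∀ {s t} → Axiom A s t → ∀ ρ → ⟦ s ⟧ ρ ≡ ⟦ t ⟧ ρ
  axiom-valid cp1 ρ = ≡.refl
  axiom-valid cp2 ρ = ≡.refl
  axiom-valid cp3 ρ = repl-identity (ρ 0)
  axiom-valid cp4 ρ = repl-assoc (ρ 2) (ρ 1) (ρ 3) (ρ 0) (ρ 4)
  axiom-valid neg ρ = ≡.refl
  axiom-valid and ρ = ≡.refl
  axiom-valid or  ρ = ≡.refl

  sound : ∀ {s t} → s ≈ t → ∀ ρ → ⟦ s ⟧ ρ ≡ ⟦ t ⟧ ρ
  sound (ax {s} {t} σ α) ρ = begin
    ⟦ sub A σ s ⟧ ρ              ≡⟨ ⟦sub⟧ σ s ρ ⟩
    ⟦ s ⟧ (λ n → ⟦ σ n ⟧ ρ)      ≡⟨ axiom-valid α _ ⟩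
    ⟦ t ⟧ (λ n → ⟦ σ n ⟧ ρ)      ≡⟨ ≡.sym (⟦sub⟧ σ t ρ) ⟩
    ⟦ sub A σ t ⟧ ρ              ∎
    where open ≡.≡-Reasoning
  sound refl ρ = ≡.refl
  sound (sym d) ρ = ≡.sym (sound d ρ)
  sound (trans d e) ρ = ≡.trans (sound d ρ) (sound e ρ)
  sound (cong◁ d e f) ρ rewrite sound d ρ | sound e ρ | sound f ρ = ≡.refl
  sound (cong¬ d) ρ rewrite sound d ρ = ≡.refl
  sound (cong∧ d e) ρ rewrite sound d ρ | sound e ρ = ≡.refl
  sound (cong∨ d e) ρ rewrite sound d ρ | sound e ρ = ≡.refl

  ⟦⌜⌝⟧≡se : ∀ P ρ → ⟦ ⌜ P ⌝ˢ ⟧ ρ ≡ se A P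
  ⟦⌜⌝⟧≡se (atom a) ρ = ≡.refl
  ⟦⌜⌝⟧≡se T ρ = ≡.refl
  ⟦⌜⌝⟧≡se F ρ = ≡.refl
  ⟦⌜⌝⟧≡se (¬ˢ P) ρ rewrite ⟦⌜⌝⟧≡se P ρ = ≡.refl
  ⟦⌜⌝⟧≡se (P ∧ˢ Q) ρ rewrite ⟦⌜⌝⟧≡se P ρ | ⟦⌜⌝⟧≡se Q ρ = ≡.refl
  ⟦⌜⌝⟧≡se (P ∨ˢ Q) ρ rewrite ⟦⌜⌝⟧≡se P ρ | ⟦⌜⌝⟧≡se Q ρ = ≡.refl

  derivable⇒se≡ : ∀ P Q → ⌜ P ⌝ˢ ≈ ⌜ Q ⌝ˢ → se A P ≡ se A Q
  derivable⇒se≡ P Q d = begin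
    se A P          ≡⟨ ≡.sym (⟦⌜⌝⟧≡se P ρ) ⟩
    ⟦ ⌜ P ⌝ˢ ⟧ ρ    ≡⟨ sound d ρ ⟩
    ⟦ ⌜ Q ⌝ˢ ⟧ ρ    ≡⟨ ⟦⌜⌝⟧≡se Q ρ ⟩
    se A Q          ∎
    where
      open ≡.≡-Reasoning
      ρ : ℕ → Tree A
      ρ _ = T

  ≈-setoid : Setoid _ _
  ≈-setoid = record
    { Carrier = CT A
    ; _≈_ = _≈_
    ; isEquivalence = record { refl = refl ; sym = sym ; trans = trans }
    }

  open SetoidReasoning ≈-setoid

  [_,_,_,_,_] : CT A → CT A → CT A → CT A → CT A → ℕ → CT A
  [ x , y , z , u , v ] 0 = x
  [ x , y , z , u , v ] 1 = y
  [ x , y , z , u , v ] 2 = z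
  [ x , y , z , u , v ] 3 = u
  [ x , y , z , u , v ] _ = v

  ⌊_⌋ : Tree A → CT A
  ⌊ T ⌋ = T
  ⌊ F ⌋ = F
  ⌊ node X a Y ⌋ = ⌊ X ⌋ ◁ atom a ▷ ⌊ Y ⌋

  ⌊repl⌋ : ∀ X Y Z → ⌊ repl A X Y Z ⌋ ≈ (⌊ Y ⌋ ◁ ⌊ X ⌋ ▷ ⌊ Z ⌋)
  ⌊repl⌋ T Y Z = sym (ax [ ⌊ Y ⌋ , ⌊ Z ⌋ , T , T , T ] cp1)
  ⌊repl⌋ F Y Z = sym (ax [ ⌊ Y ⌋ , ⌊ Z ⌋ , T , T , T ] cp2)
  ⌊repl⌋ (node X₁ a X₂) Y Z = begin
    ⌊ repl A X₁ Y Z ⌋ ◁ atom a ▷ ⌊ repl A X₂ Y Z ⌋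
      ≈⟨ cong◁ (⌊repl⌋ X₁ Y Z) refl (⌊repl⌋ X₂ Y Z) ⟩
    (⌊ Y ⌋ ◁ ⌊ X₁ ⌋ ▷ ⌊ Z ⌋) ◁ atom a ▷ (⌊ Y ⌋ ◁ ⌊ X₂ ⌋ ▷ ⌊ Z ⌋)
      ≈⟨ sym (ax [ ⌊ Y ⌋ , ⌊ X₁ ⌋ , atom a , ⌊ X₂ ⌋ , ⌊ Z ⌋ ] cp4) ⟩
    ⌊ Y ⌋ ◁ (⌊ X₁ ⌋ ◁ atom a ▷ ⌊ X₂ ⌋) ▷ ⌊ Z ⌋
      ∎

  ⌜⌝≈⌊se⌋ : ∀ P → ⌜ P ⌝ˢ ≈ ⌊ se A P ⌋
  ⌜⌝≈⌊se⌋ (atom a) = sym (ax [ atom a , T , T , T , T ] cp3)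
  ⌜⌝≈⌊se⌋ T = refl
  ⌜⌝≈⌊se⌋ F = refl
  ⌜⌝≈⌊se⌋ (¬ˢ P) = begin
    ¬ᶜ ⌜ P ⌝ˢ                    ≈⟨ ax [ ⌜ P ⌝ˢ , T , T , T , T ] neg ⟩
    F ◁ ⌜ P ⌝ˢ ▷ T               ≈⟨ cong◁ refl (⌜⌝≈⌊se⌋ P) refl ⟩
    F ◁ ⌊ se A P ⌋ ▷ T           ≈⟨ sym (⌊repl⌋ (se A P) F T) ⟩
    ⌊ repl A (se A P) F T ⌋      ∎
  ⌜⌝≈⌊se⌋ (P ∧ˢ Q) = begin
    ⌜ P ⌝ˢ ∧ᶜ ⌜ Q ⌝ˢ                 ≈⟨ ax [ ⌜ P ⌝ˢ , ⌜ Q ⌝ˢ , T , T , T ] and ⟩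
    ⌜ Q ⌝ˢ ◁ ⌜ P ⌝ˢ ▷ F              ≈⟨ cong◁ (⌜⌝≈⌊se⌋ Q) (⌜⌝≈⌊se⌋ P) refl ⟩
    ⌊ se A Q ⌋ ◁ ⌊ se A P ⌋ ▷ F      ≈⟨ sym (⌊repl⌋ (se A P) (se A Q) F) ⟩
    ⌊ repl A (se A P) (se A Q) F ⌋   ∎
  ⌜⌝≈⌊se⌋ (P ∨ˢ Q) = begin
    ⌜ P ⌝ˢ ∨ᶜ ⌜ Q ⌝ˢ                 ≈⟨ ax [ ⌜ P ⌝ˢ , ⌜ Q ⌝ˢ , T , T , T ] or ⟩
    T ◁ ⌜ P ⌝ˢ ▷ ⌜ Q ⌝ˢ              ≈⟨ cong◁ refl (⌜⌝≈⌊se⌋ P) (⌜⌝≈⌊se⌋ Q) ⟩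
    T ◁ ⌊ se A P ⌋ ▷ ⌊ se A Q ⌋      ≈⟨ sym (⌊repl⌋ (se A P) T (se A Q)) ⟩
    ⌊ repl A (se A P) T (se A Q) ⌋   ∎

  se≡⇒derivable : ∀ P Q → se A P ≡ se A Q → ⌜ P ⌝ˢ ≈ ⌜ Q ⌝ˢ
  se≡⇒derivable P Q se≡ = begin
    ⌜ P ⌝ˢ          ≈⟨ ⌜⌝≈⌊se⌋ P ⟩
    ⌊ se A P ⌋      ≡⟨ ≡.cong ⌊_⌋ se≡ ⟩
    ⌊ se A Q ⌋      ≈⟨ sym (⌜⌝≈⌊se⌋ Q) ⟩
    ⌜ Q ⌝ˢ          ∎

mainTheorem5 : (A : Set) → A ↣ ℕ → (P Q : ST A) →
    FSCLse⊨ A P Q ⇔ FSCL⊨ A P Q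
mainTheorem5 A _ P Q = mk⇔ (se≡⇒derivable P Q) (derivable⇒se≡ P Q)
  where open SoundAndComplete A
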